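{- Let $\mathcal{M}=(X,\mathcal{C},\mathcal{V})$ be a closure model. For all $x_1,x_2\in X$, if $x_1$ and $x_2$ are CM-bisimilar in $\mathcal{M}$, then for every ${\tt IML}$ formula $\Phi$, $\mathcal{M},x_1\models\Phi$ iff $\mathcal{M},x_2\models\Phi$.
   Context: Fix a set $\mathtt{AP}$ of atomic propositions. A closure space is a pair $(X,\mathcal{C})$ with $\mathcal{C}:\mathcal{P}(X)\to\mathcal{P}(X)$ such that $\mathcal{C}(\emptyset)=\emptyset$, $A\subseteq\mathcal{C}(A)$ and $\mathcal{C}(A_1\cup A_2)=\mathcal{C}(A_1)\cup\mathcal{C}(A_2)$. A closure model is $\mathcal{M}=(X,\mathcal{C},\mathcal{V})$ with $(X,\mathcal{C})$ a closure space and $\mathcal{V}:\mathtt{AP}\to\mathcal{P}(X)$. The interior is $\mathcal{I}(A)=X\setminus\mathcal{C}(X\setminus A)$. A symmetric relation $B\subseteq X\times X$ is a CM-bisimulation if whenever $(x_1,x_2)\in B$: (1) for all $p\in\mathtt{AP}$, $x_1\in\mathcal{V}(p)$ iff $x_2\in\mathcal{V}(p)$; (2) for every $S_1\subseteq X$ with $x_1\in\mathcal{I}(S_1)$ there is $S_2\subseteq X$ with $x_2\in\mathcal{I}(S_2)$ such that each $s_2\in S_2$ has some $s_1\in S_1$ with $(s_1,s_2)\in B$. Points are CM-bisimilar if some CM-bisimulation contains the pair. ${\tt IML}$ formulas: $\Phi::=p\mid\neg\Phi\mid\bigwedge_{i\in I}\Phi_i\mid\mathcal{N}\Phi$ ($I$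 arbitrary index set); $x\models p$ iff $x\in\mathcal{V}(p)$, usual Boolean clauses, and $x\models\mathcal{N}\Phi$ iff $x\in\mathcal{C}(\{y:y\models\Phi\})$. -}

module Defs where

open import Level using (0ℓ)
open import Data.Product using (Σ; _×_; _,_)
open import Data.Sum using (_⊎_)
open import Data.Empty using (⊥)
open import Relation.Nullary using (¬_)
open import Function.Bundles using (_⇔_)

Subset : Set → Set₁
Subset X = X → Set

module _ {X : Set} where

  ∅ : Subset X
  ∅ _ = ⊥

  _⊆_ : Subset X → Subset X → Set
  A ⊆ B = ∀ x → A x → B x

  _≐_ : Subset X → Subset X → Set
  A ≐ B = (A ⊆ B) × (B ⊆ A)

  _∪_ : Subset X → Subset X → Subset X
  (A ∪ B) x = A x ⊎ B x

  ∁ : Subset X → Subset X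
  ∁ A x = ¬ A x

-- Closure space (X, 𝒞).  Since subsets are predicates, we also require that
-- 𝒞 respects extensional equality of subsets (automatic for a function on 𝒫(X)).
record ClosureSpace (X : Set) : Set₁ where
  field
    𝒞        : Subset X → Subset X
    𝒞-resp-≐ : ∀ {A B} → A ≐ B → 𝒞 A ≐ 𝒞 B
    𝒞-∅      : 𝒞 ∅ ≐ ∅
    𝒞-incl   : ∀ A → A ⊆ 𝒞 A
    𝒞-∪      : ∀ A₁ A₂ → 𝒞 (A₁ ∪ A₂) ≐ (𝒞 A₁ ∪ 𝒞 A₂)

  ℐ : Subset X → Subset X
  ℐ A = ∁ (𝒞 (∁ A))

record ClosureModel (AP : Set) (X : Set) : Set₁ where
  field
    space : ClosureSpace X
    𝒱     : AP → Subset X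
  open ClosureSpace space public

data IML (AP : Set) : Set₁ where
  atom : AP → IML AP
  neg  : IML AP → IML AP
  conj : (I : Set) → (I → IML AP) → IML AP
  nbh  : IML AP → IML AP

module _ {AP X : Set} (M : ClosureModel AP X) where
  open ClosureModel M

  _⊨_ : X → IML AP → Set
  x ⊨ atom p    = 𝒱 p x
  x ⊨ neg Φ     = ¬ (x ⊨ Φ)
  x ⊨ conj I Φs = ∀ i → x ⊨ Φs i
  x ⊨ nbh Φ     = 𝒞 (λ y → y ⊨ Φ) x

  record IsCMBisimulation (B : X → X → Set) : Set₁ where
    field
      symmetric : ∀ {x₁ x₂} → B x₁ x₂ → B x₂ x₁
      atoms     : ∀ {x₁ x₂} → B x₁ x₂ → ∀ p → (𝒱 p x₁ ⇔ 𝒱 p x₂)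
      zig       : ∀ {x₁ x₂} → B x₁ x₂ → ∀ (S₁ : Subset X) → ℐ S₁ x₁ →
                  Σ (Subset X) λ S₂ → ℐ S₂ x₂ ×
                    (∀ s₂ → S₂ s₂ → Σ X λ s₁ → S₁ s₁ × B s₁ s₂)

  CM-bisimilar : X → X → Set₁
  CM-bisimilar x₁ x₂ = Σ (X → X → Set) λ B → IsCMBisimulation B × B x₁ x₂

-- Induction on Φ, proving the forward implication for every related pair at once; symmetry of
-- the bisimulation gives the converse.  For 𝒩Φ with x ∈ 𝒞⟦Φ⟧ but y ∉ 𝒞⟦Φ⟧, classically y lies in
-- the interior of ∁⟦Φ⟧, so the zig condition yields a neighbourhood S of x consisting of points
-- bisimilar to points refuting Φ.  By induction S is disjoint from ⟦Φ⟧, and monotonicity of 𝒞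
-- then keeps x out of 𝒞⟦Φ⟧.
module Submission where

open import Defs
open import Level using (0ℓ)
open import Axiom.ExcludedMiddle using (ExcludedMiddle)
open import Axiom.DoubleNegationElimination using (DoubleNegationElimination; em⇒dne)
open import Function.Bundles using (_⇔_; mk⇔; Equivalence)
open import Data.Product using (_,_; proj₁; proj₂)
open import Data.Sum using (inj₁; inj₂; [_,_]′)

module ClosureSpaceProperties {X : Set} (space : ClosureSpace X) where
  open ClosureSpace space

  𝒞-mono : ∀ {A C} → A ⊆ C → 𝒞 A ⊆ 𝒞 C
  𝒞-mono {A} {C} A⊆C x x∈𝒞A =
    proj₁ (𝒞-resp-≐ A∪C≐C) x (proj₂ (𝒞-∪ A C) x (inj₁ x∈𝒞A))
    where
    A∪C≐C : (A ∪ C) ≐ C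
    A∪C≐C = (λ y → [ A⊆C y , (λ y∈C → y∈C) ]′) , (λ _ → inj₂)

  ℐ⊆∁𝒞-of-disjoint : ∀ {A S} → A ⊆ ∁ S → ℐ S ⊆ ∁ (𝒞 A)
  ℐ⊆∁𝒞-of-disjoint A⊆∁S x x∈ℐS x∈𝒞A = x∈ℐS (𝒞-mono A⊆∁S x x∈𝒞A)

  ∁𝒞⊆ℐ∁ : DoubleNegationElimination 0ℓ → ∀ {A} → ∁ (𝒞 A) ⊆ ℐ (∁ A)
  ∁𝒞⊆ℐ∁ dne x x∉𝒞A x∈𝒞∁∁A = x∉𝒞A (𝒞-mono (λ y → dne) x x∈𝒞∁∁A)

module Bisimulation (dne : DoubleNegationElimination 0ℓ) {AP X : Set} (M : ClosureModel AP X)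
                    {B : X → X → Set} (isB : IsCMBisimulation M B) where
  open ClosureModel M
  open ClosureSpaceProperties space
  open IsCMBisimulation isB

  ⟦_⟧ : IML AP → Subset X
  ⟦ Φ ⟧ x = _⊨_ M x Φ

  ⊨-transfer : ∀ Φ {x y} → B x y → ⟦ Φ ⟧ x → ⟦ Φ ⟧ y
  ⊨-transfer (atom p)    xBy x⊨p        = Equivalence.to (atoms xBy p) x⊨p
  ⊨-transfer (neg Φ)     xBy x⊭Φ y⊨Φ    = x⊭Φ (⊨-transfer Φ (symmetric xBy) y⊨Φ)
  ⊨-transfer (conj I Φs) xBy x⊨Φs i     = ⊨-transfer (Φs i) xBy (x⊨Φs i)
  ⊨-transfer (nbh Φ) {x} {y} xBy x∈𝒞⟦Φ⟧ = dne λ y∉𝒞⟦Φ⟧ →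
    let (S , x∈ℐS , S-refuters) = zig (symmetric xBy) (∁ ⟦ Φ ⟧) (∁𝒞⊆ℐ∁ dne y y∉𝒞⟦Φ⟧)
        ⟦Φ⟧⊆∁S : ⟦ Φ ⟧ ⊆ ∁ S
        ⟦Φ⟧⊆∁S z z⊨Φ z∈S =
          let (s , s⊭Φ , sBz) = S-refuters z z∈S
          in s⊭Φ (⊨-transfer Φ (symmetric sBz) z⊨Φ)
    in ℐ⊆∁𝒞-of-disjoint ⟦Φ⟧⊆∁S x x∈ℐS x∈𝒞⟦Φ⟧

lemma3p6 : ExcludedMiddle 0ℓ → {AP X : Set} (M : ClosureModel AP X) →
    ∀ (x₁ x₂ : X) → CM-bisimilar M x₁ x₂ →
    ∀ (Φ : IML AP) → (_⊨_ M x₁ Φ ⇔ _⊨_ M x₂ Φ)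
lemma3p6 em M x₁ x₂ (B , isB , x₁Bx₂) Φ =
  mk⇔ (⊨-transfer Φ x₁Bx₂) (⊨-transfer Φ (IsCMBisimulation.symmetric isB x₁Bx₂))
  where open Bisimulation (em⇒dne em) M isB
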